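{- Let $G=(V,E)$ be a finite simple graph of class two and let $C\subseteq V$ be a minimum vertex cover of $G$. Then for every nonempty independent set $A\subseteq C$ we have $|N_{V-C}(A)|>|A|$.
   Context: All graphs are finite and simple. For $X\subseteq V$, $N(X)$ is the union of neighborhoods of vertices of $X$ and $N_S(X)=N(X)\cap S$. $\beta(G)$ is the size of a minimum vertex cover. Alcuin problem: the vertices of $G$ are items initially on the left bank of a river; a man with a boat of capacity $b$ (a positive integer) must carry them all to the right bank so that no two adjacent vertices are ever left together on a bank. Formally, a feasible schedule for capacity $b$ is a sequence of triples $(L_k,B_k,R_k)$, $k=1,\dots,s$, $s$ odd, such that: each triple is a partition of $V$; $L_k$ and $R_k$ are independent sets; $|B_k|\le b$; $L_1\cup B_1=V$; $B_s\cup R_s=V$; for even $k$, $L_k=L_{k-1}$ and $B_k\cup R_k=B_{k-1}\cup R_{k-1}$; for odd $k\ge 3$, $R_k=R_{k-1}$ and $B_k\cup L_k=B_{k-1}\cup L_{k-1}$. The Alcuin number $c(G)$ is the least positive integer $b$ for which a feasible schedule exists. One always has $\beta(G)\le c(G)\le \beta(G)+1$; $G$ is of class one if $c(G)=\beta(G)$ and of class two if $c(G)=\beta(G)+1$. -}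

module Defs where

open import Data.Nat using (ℕ; zero; suc; _+_; _∸_; _≤_; _<_)
open import Data.Bool using (Bool; true; false; T; _∧_)
open import Data.Fin using (Fin)
open import Data.Fin.Subset using (Subset; _∈_; _∉_; _∪_; _∩_; ∁; ∣_∣)
  renaming (⊥ to ∅; ⊤ to Full)
open import Data.List using (map; allFin)
open import Data.Bool.ListAction using (or)
open import Data.Vec using (tabulate; lookup)
open import Data.Sum using (_⊎_)
open import Data.Product using (Σ; ∃; _×_; _,_)
open import Relation.Binary.PropositionalEquality using (_≡_)
open import Relation.Nullary using (¬_)

record Graph : Set where
  field
    n       : ℕ
    adj     : Fin n → Fin n → Bool
    sym     : ∀ u v → adj u v ≡ adj v u
    irrefl  : ∀ v → adj v v ≡ false

open Graph public

Vertex : Graph → Set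
Vertex G = Fin (n G)

VSet : Graph → Set
VSet G = Subset (n G)

Adj : (G : Graph) → Vertex G → Vertex G → Set
Adj G u v = T (adj G u v)

Independent : (G : Graph) → VSet G → Set
Independent G S = ∀ u v → u ∈ S → v ∈ S → ¬ Adj G u v

VertexCover : (G : Graph) → VSet G → Set
VertexCover G C = ∀ u v → Adj G u v → (u ∈ C) ⊎ (v ∈ C)

MinVertexCover : (G : Graph) → VSet G → Set
MinVertexCover G C = VertexCover G C × (∀ D → VertexCover G D → ∣ C ∣ ≤ ∣ D ∣)

IsVertexCoverNumber : Graph → ℕ → Set
IsVertexCoverNumber G k = Σ (VSet G) λ C → MinVertexCover G C × ∣ C ∣ ≡ k

-- N(X): union of the neighbourhoods of vertices of X
N : (G : Graph) → VSet G → VSet G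
N G X = tabulate λ w → or (map (λ a → lookup X a ∧ adj G a w) (allFin (n G)))

N[_] : (G : Graph) → VSet G → VSet G → VSet G
N[ G ] S X = N G X ∩ S

Even Odd : ℕ → Set
Even k = ∃ λ j → k ≡ j + j
Odd k = ∃ λ j → k ≡ suc (j + j)

-- a state (L , B , R): left bank, boat, right bank
record Triple (G : Graph) : Set where
  constructor ⟨_,_,_⟩
  field
    L B R : VSet G

open Triple public

Partition : (G : Graph) → Triple G → Set
Partition G t =
  (L t ∪ B t) ∪ R t ≡ Full × L t ∩ B t ≡ ∅ × L t ∩ R t ≡ ∅ × B t ∩ R t ≡ ∅

-- A feasible schedule of length s for boat capacity b.
-- The schedule is a function ℕ → Triple G; only indices 1 … s matter
-- (index convention as in the paper: k = 1, …, s).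
record FeasibleSchedule (G : Graph) (b : ℕ) : Set where
  field
    s       : ℕ
    s-odd   : Odd s
    sched   : ℕ → Triple G
    part    : ∀ k → 1 ≤ k → k ≤ s → Partition G (sched k)
    indL    : ∀ k → 1 ≤ k → k ≤ s → Independent G (L (sched k))
    indR    : ∀ k → 1 ≤ k → k ≤ s → Independent G (R (sched k))
    cap     : ∀ k → 1 ≤ k → k ≤ s → ∣ B (sched k) ∣ ≤ b
    start   : L (sched 1) ∪ B (sched 1) ≡ Full
    finish  : B (sched s) ∪ R (sched s) ≡ Full
    evenL   : ∀ k → Even k → 1 ≤ k → k ≤ s → L (sched k) ≡ L (sched (k ∸ 1))
    evenBR  : ∀ k → Even k → 1 ≤ k → k ≤ s →
              B (sched k) ∪ R (sched k) ≡ B (sched (k ∸ 1)) ∪ R (sched (k ∸ 1))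
    oddR    : ∀ k → Odd k → 3 ≤ k → k ≤ s → R (sched k) ≡ R (sched (k ∸ 1))
    oddBL   : ∀ k → Odd k → 3 ≤ k → k ≤ s →
              B (sched k) ∪ L (sched k) ≡ B (sched (k ∸ 1)) ∪ L (sched (k ∸ 1))

IsAlcuinNumber : Graph → ℕ → Set
IsAlcuinNumber G c =
  1 ≤ c × FeasibleSchedule G c × (∀ b → 1 ≤ b → FeasibleSchedule G b → c ≤ b)

ClassTwo : Graph → Set
ClassTwo G = ∃ λ β → ∃ λ c →
  IsVertexCoverNumber G β × IsAlcuinNumber G c × c ≡ suc β

-- If |N_{V−C}(A)| ≤ |A|, there is a schedule with capacity |C| = β(G),
-- contradicting c(G) = β(G) + 1.  The boat first carries all of C, leaves A on
-- the right bank and keeps C − A aboard for the whole journey.  Since A ≠ ∅ one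
-- seat is free, and the vertices of V − C − N(A) are ferried across one at a
-- time; finally the at most |A| vertices of N_{V−C}(A) take the seats of A.  The
-- left bank only ever holds vertices of V − C, and the right bank only vertices
-- of A and V − C − N(A), so both stay independent because C covers every edge,
-- A is independent and no edge joins A to V − C − N(A).
module Submission where

open import Defs renaming (sym to adj-sym)
open import Data.Nat using (ℕ; zero; suc; _+_; _∸_; _≤_; _<_; z≤n; s≤s; ⌊_/2⌋)
open import Data.Nat.Properties
  using ( ≤-refl; ≤-trans; <⇒≤; ≤-pred; ≤∧≢⇒<; ≮⇒≥; <⇒≢; ≤⇒≯; <⇒≱; +-suc; +-comm
        ; +-identityʳ; +-mono-≤; +-monoʳ-≤; +-mono-<; m∸n≤m; m≤n+m∸n; m<n⇒m<1+n
        ; m≤n⇒m<n∨m≡n; suc-injective; 1+n≢0; _≟_; even≢odd; n≡⌊n+n/2⌋; <-cmp; ≤-<-trans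
        ; module ≤-Reasoning )
  renaming (_<?_ to _<ℕ?_)
open import Data.Bool using (_∧_; T)
open import Data.Bool.Properties using (T-≡; T-∧)
open import Data.Fin using (Fin; toℕ)
open import Data.Fin.Properties using (toℕ-injective; toℕ<n)
open import Data.Fin.Subset
  using (Subset; _∈_; _∉_; _⊆_; _∪_; _∩_; ∁; ∣_∣; Nonempty; outside; inside; ⁅_⁆)
  renaming (⊥ to ∅; ⊤ to Full)
open import Data.Fin.Subset.Properties
  using ( ⊆-antisym; ⊆⊤; ⊥⊆; _∈?_; x∈p∪q⁺; x∈p∪q⁻; x∈p∩q⁺; x∈p∩q⁻
        ; x∈∁p⇒x∉p; x∉p⇒x∈∁p; p⊆q⇒∣p∣≤∣q∣; ∣p∩q∣≤∣q∣; x∈⁅x⁆; x∈⁅y⁆⇒x≡y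
        ; ∣⁅x⁆∣≡1; nonempty?; Empty-unique; ∣⊥∣≡0 )
open import Data.List.Membership.Propositional.Properties using (∈-allFin)
open import Data.List.Relation.Unary.Any.Properties using (any⁺)
import Data.List.Relation.Unary.Any as Any
open import Data.Vec using (tabulate; lookup; _∷_; [])
open import Data.Vec.Properties using (lookup∘tabulate; []=⇒lookup; lookup⇒[]=)
open import Data.Product using (_×_; _,_; proj₁; proj₂)
open import Data.Sum using (_⊎_; inj₁; inj₂; [_,_]′)
import Data.Sum as Sum
open import Data.Empty using (⊥-elim)
open import Function using (_∘_)
open import Function.Bundles using (_⇔_; mk⇔; Equivalence)
open import Function.Properties.Equivalence using () renaming (trans to ⇔-trans; sym to ⇔-sym)
open import Relation.Nullary using (¬_; yes; no; does; contradiction)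
open import Relation.Nullary.Decidable using (dec-true)
open import Relation.Binary.Definitions using (DecidableEquality; tri<; tri≈; tri>)
open import Relation.Binary.PropositionalEquality
  using (_≡_; _≢_; refl; sym; trans; cong; subst; module ≡-Reasoning)

open Equivalence using (to; from)

tripTime : ℕ → ℕ
tripTime j = suc (j + j)

tripTime-injective : ∀ {i j} → tripTime i ≡ tripTime j → i ≡ j
tripTime-injective {i} {j} eq = begin
  i             ≡⟨ n≡⌊n+n/2⌋ i ⟩
  ⌊ i + i /2⌋   ≡⟨ cong ⌊_/2⌋ (suc-injective eq) ⟩
  ⌊ j + j /2⌋   ≡⟨ sym (n≡⌊n+n/2⌋ j) ⟩
  j             ∎
  where open ≡-Reasoning

tripTime-mono-< : ∀ {i j} → i < j → tripTime i < tripTime j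
tripTime-mono-< i<j = s≤s (+-mono-< i<j i<j)

i+i≢tripTime : ∀ i j → i + i ≢ tripTime j
i+i≢tripTime i j eq = even≢odd i j (begin
  i + (i + 0)        ≡⟨ cong (i +_) (+-identityʳ i) ⟩
  i + i              ≡⟨ eq ⟩
  suc (j + j)        ≡⟨ cong (λ x → suc (j + x)) (sym (+-identityʳ j)) ⟩
  suc (j + (j + 0))  ∎)
  where open ≡-Reasoning

even-<-tripTime : ∀ {k} j → Even k → k < tripTime j ⇔ k ∸ 1 < tripTime j
even-<-tripTime {k} j (i , refl) = mk⇔
  (≤-<-trans (m∸n≤m k 1))
  (λ k∸1<t → ≤∧≢⇒< (≤-trans (m≤n+m∸n k 1) k∸1<t) (i+i≢tripTime i j))

odd-tripTime-< : ∀ {k} j → Odd k → tripTime j < k ⇔ tripTime j < k ∸ 1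
odd-tripTime-< j (i , refl) = mk⇔
  (λ t<k → ≤∧≢⇒< (≤-pred t<k) (i+i≢tripTime i j ∘ sym))
  m<n⇒m<1+n

data Place : Set where
  left boat right : Place

_≟ₚ_ : DecidableEquality Place
left  ≟ₚ left  = yes refl
left  ≟ₚ boat  = no λ ()
left  ≟ₚ right = no λ ()
boat  ≟ₚ left  = no λ ()
boat  ≟ₚ boat  = yes refl
boat  ≟ₚ right = no λ ()
right ≟ₚ left  = no λ ()
right ≟ₚ boat  = no λ ()
right ≟ₚ right = yes refl

-- crosses j: on the left bank before time 2j + 1, in the boat at that time,
-- on the right bank after it.
data Crossing : Set where
  aboard  : Crossing
  crosses : ℕ → Crossing

place : Crossing → ℕ → Place
place aboard      k = boat
place (crosses j) k with <-cmp k (tripTime j)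
... | tri< _ _ _ = left
... | tri≈ _ _ _ = boat
... | tri> _ _ _ = right

place-crosses-left : ∀ j k → place (crosses j) k ≡ left ⇔ k < tripTime j
place-crosses-left j k with <-cmp k (tripTime j)
... | tri< k<t _ _ = mk⇔ (λ _ → k<t) (λ _ → refl)
... | tri≈ k≮t _ _ = mk⇔ (λ ()) (⊥-elim ∘ k≮t)
... | tri> k≮t _ _ = mk⇔ (λ ()) (⊥-elim ∘ k≮t)

place-crosses-boat : ∀ j k → place (crosses j) k ≡ boat ⇔ k ≡ tripTime j
place-crosses-boat j k with <-cmp k (tripTime j)
... | tri< _ k≢t _ = mk⇔ (λ ()) (⊥-elim ∘ k≢t)
... | tri≈ _ k≡t _ = mk⇔ (λ _ → k≡t) (λ _ → refl)
... | tri> _ k≢t _ = mk⇔ (λ ()) (⊥-elim ∘ k≢t)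

place-crosses-right : ∀ j k → place (crosses j) k ≡ right ⇔ tripTime j < k
place-crosses-right j k with <-cmp k (tripTime j)
... | tri< _ _ t≮k = mk⇔ (λ ()) (⊥-elim ∘ t≮k)
... | tri≈ _ _ t≮k = mk⇔ (λ ()) (⊥-elim ∘ t≮k)
... | tri> _ _ t<k = mk⇔ (λ _ → t<k) (λ _ → refl)

-- Items board at odd times and land at even ones, so leftness can only change
-- on odd steps and rightness only on even steps.
left-stable-at-even : ∀ c {k} → Even k → place c k ≡ left ⇔ place c (k ∸ 1) ≡ left
left-stable-at-even aboard      _      = mk⇔ (λ ()) (λ ())
left-stable-at-even (crosses j) {k} ek =
  ⇔-trans (place-crosses-left j k)
    (⇔-trans (even-<-tripTime j ek) (⇔-sym (place-crosses-left j (k ∸ 1))))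

right-stable-at-odd : ∀ c {k} → Odd k → place c k ≡ right ⇔ place c (k ∸ 1) ≡ right
right-stable-at-odd aboard      _      = mk⇔ (λ ()) (λ ())
right-stable-at-odd (crosses j) {k} ok =
  ⇔-trans (place-crosses-right j k)
    (⇔-trans (odd-tripTime-< j ok) (⇔-sym (place-crosses-right j (k ∸ 1))))

left-or-boat-at-start : ∀ c → place c 1 ≡ left ⊎ place c 1 ≡ boat
left-or-boat-at-start aboard            = inj₂ refl
left-or-boat-at-start (crosses zero)    = inj₂ refl
left-or-boat-at-start (crosses (suc j)) =
  inj₁ (from (place-crosses-left (suc j) 1) (s≤s (s≤s z≤n)))

boat-or-right-after-last-trip : ∀ {m} c → (∀ {j} → c ≡ crosses j → j ≤ m) →
  place c (tripTime m) ≡ boat ⊎ place c (tripTime m) ≡ right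
boat-or-right-after-last-trip aboard      _       = inj₁ refl
boat-or-right-after-last-trip {m} (crosses j) j≤last with m≤n⇒m<n∨m≡n (j≤last refl)
... | inj₁ j<m    = inj₂ (from (place-crosses-right j _) (tripTime-mono-< j<m))
... | inj₂ refl   = inj₁ (from (place-crosses-boat j _) refl)

bank : ∀ {n} → (Fin n → Place) → Place → Subset n
bank π p = tabulate (λ v → does (π v ≟ₚ p))

∈-bank⁻ : ∀ {n} (π : Fin n → Place) {v p} → v ∈ bank π p → π v ≡ p
∈-bank⁻ π {v} {p} v∈ with π v ≟ₚ p | trans (sym (lookup∘tabulate _ v)) ([]=⇒lookup v∈)
... | yes πv≡p | _ = πv≡p
... | no _     | ()

∈-bank⁺ : ∀ {n} (π : Fin n → Place) {v p} → π v ≡ p → v ∈ bank π p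
∈-bank⁺ π {v} {p} πv≡p =
  lookup⇒[]= v _ (trans (lookup∘tabulate _ v) (dec-true (π v ≟ₚ p) πv≡p))

module _ {n} (π : Fin n → Place) where

  bank-disjoint : ∀ {p q} → p ≢ q → bank π p ∩ bank π q ≡ ∅
  bank-disjoint p≢q = ⊆-antisym
    (λ v∈ → let (v∈p , v∈q) = x∈p∩q⁻ _ _ v∈ in
            ⊥-elim (p≢q (trans (sym (∈-bank⁻ π v∈p)) (∈-bank⁻ π v∈q))))
    ⊥⊆

  bank-∪-full : ∀ {p q} → (∀ v → π v ≡ p ⊎ π v ≡ q) → bank π p ∪ bank π q ≡ Full
  bank-∪-full everywhere =
    ⊆-antisym ⊆⊤ λ {v} _ → x∈p∪q⁺ (Sum.map (∈-bank⁺ π) (∈-bank⁺ π) (everywhere v))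

  bank-cong : ∀ {π′ : Fin n → Place} {p} → (∀ v → π v ≡ p ⇔ π′ v ≡ p) → bank π p ≡ bank π′ p
  bank-cong {π′} same = ⊆-antisym (λ {v} → ∈-bank⁺ π′ ∘ to (same v) ∘ ∈-bank⁻ π)
                                  (λ {v} → ∈-bank⁺ π ∘ from (same v) ∘ ∈-bank⁻ π′)

  bank-∪≡∁bank : ∀ {p q r} → q ≢ p → r ≢ p → (∀ x → x ≢ p → x ≡ q ⊎ x ≡ r) →
    bank π q ∪ bank π r ≡ ∁ (bank π p)
  bank-∪≡∁bank {p} q≢p r≢p others = ⊆-antisym
    (λ v∈ → x∉p⇒x∈∁p λ v∈p →
      [ (λ v∈q → q≢p (trans (sym (∈-bank⁻ π v∈q)) (∈-bank⁻ π v∈p)))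
      , (λ v∈r → r≢p (trans (sym (∈-bank⁻ π v∈r)) (∈-bank⁻ π v∈p))) ]′ (x∈p∪q⁻ _ _ v∈))
    (λ {v} v∈ → x∈p∪q⁺ (Sum.map (∈-bank⁺ π) (∈-bank⁺ π) (others (π v) (x∈∁p⇒x∉p v∈ ∘ ∈-bank⁺ π))))

  boat∪right≡∁left : bank π boat ∪ bank π right ≡ ∁ (bank π left)
  boat∪right≡∁left = bank-∪≡∁bank (λ ()) (λ ()) λ
    { left  ≢left → ⊥-elim (≢left refl) ; boat _ → inj₁ refl ; right _ → inj₂ refl }

  boat∪left≡∁right : bank π boat ∪ bank π left ≡ ∁ (bank π right)
  boat∪left≡∁right = bank-∪≡∁bank (λ ()) (λ ()) λ
    { right ≢right → ⊥-elim (≢right refl) ; boat _ → inj₁ refl ; left _ → inj₂ refl }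

banks : (G : Graph) → (Vertex G → Place) → Triple G
banks G π = ⟨ bank π left , bank π boat , bank π right ⟩

banks-partition : (G : Graph) (π : Vertex G → Place) → Partition G (banks G π)
banks-partition G π =
  ⊆-antisym ⊆⊤ (λ {v} _ → somewhere v (π v) refl) ,
  bank-disjoint π (λ ()) , bank-disjoint π (λ ()) , bank-disjoint π (λ ())
  where
  somewhere : ∀ v p → π v ≡ p → v ∈ (bank π left ∪ bank π boat) ∪ bank π right
  somewhere v left  eq = x∈p∪q⁺ (inj₁ (x∈p∪q⁺ (inj₁ (∈-bank⁺ π eq))))
  somewhere v boat  eq = x∈p∪q⁺ (inj₁ (x∈p∪q⁺ (inj₂ (∈-bank⁺ π eq))))
  somewhere v right eq = x∈p∪q⁺ (inj₂ (∈-bank⁺ π eq))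

positions : ∀ {n} → (Fin n → Crossing) → ℕ → Fin n → Place
positions τ k v = place (τ v) k

snapshot : (G : Graph) → (Vertex G → Crossing) → ℕ → Triple G
snapshot G τ k = banks G (positions τ k)

crossings-schedule : (G : Graph) (b m : ℕ) (τ : Vertex G → Crossing) →
  (∀ v {j} → τ v ≡ crosses j → j ≤ m) →
  (∀ k → 1 ≤ k → k ≤ tripTime m → Independent G (L (snapshot G τ k))) →
  (∀ k → 1 ≤ k → k ≤ tripTime m → Independent G (R (snapshot G τ k))) →
  (∀ k → 1 ≤ k → k ≤ tripTime m → ∣ B (snapshot G τ k) ∣ ≤ b) →
  FeasibleSchedule G b
crossings-schedule G b m τ within-m indL indR cap = record
  { s      = tripTime m
  ; s-odd  = m , refl
  ; sched  = snapshot G τ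
  ; part   = λ k _ _ → banks-partition G (positions τ k)
  ; indL   = indL
  ; indR   = indR
  ; cap    = cap
  ; start  = bank-∪-full (positions τ 1) (λ v → left-or-boat-at-start (τ v))
  ; finish = bank-∪-full (positions τ (tripTime m))
               (λ v → boat-or-right-after-last-trip (τ v) (within-m v))
  ; evenL  = λ k ek _ _ → left-stable ek
  ; evenBR = λ k ek _ _ → begin
      B (snapshot G τ k) ∪ R (snapshot G τ k)   ≡⟨ boat∪right≡∁left (positions τ k) ⟩
      ∁ (L (snapshot G τ k))                     ≡⟨ cong ∁ (left-stable ek) ⟩
      ∁ (L (snapshot G τ (k ∸ 1)))               ≡⟨ sym (boat∪right≡∁left (positions τ (k ∸ 1))) ⟩
      B (snapshot G τ (k ∸ 1)) ∪ R (snapshot G τ (k ∸ 1)) ∎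
  ; oddR   = λ k ok _ _ → right-stable ok
  ; oddBL  = λ k ok _ _ → begin
      B (snapshot G τ k) ∪ L (snapshot G τ k)   ≡⟨ boat∪left≡∁right (positions τ k) ⟩
      ∁ (R (snapshot G τ k))                     ≡⟨ cong ∁ (right-stable ok) ⟩
      ∁ (R (snapshot G τ (k ∸ 1)))               ≡⟨ sym (boat∪left≡∁right (positions τ (k ∸ 1))) ⟩
      B (snapshot G τ (k ∸ 1)) ∪ L (snapshot G τ (k ∸ 1)) ∎
  }
  where
  open ≡-Reasoning
  left-stable : ∀ {k} → Even k → L (snapshot G τ k) ≡ L (snapshot G τ (k ∸ 1))
  left-stable ek = bank-cong (positions τ _) (λ v → left-stable-at-even (τ v) ek)
  right-stable : ∀ {k} → Odd k → R (snapshot G τ k) ≡ R (snapshot G τ (k ∸ 1))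
  right-stable ok = bank-cong (positions τ _) (λ v → right-stable-at-odd (τ v) ok)

∣p∣≡∣p∩∁q∣+∣p∩q∣ : ∀ {n} (p q : Subset n) → ∣ p ∣ ≡ ∣ p ∩ ∁ q ∣ + ∣ p ∩ q ∣
∣p∣≡∣p∩∁q∣+∣p∩q∣ []            []            = refl
∣p∣≡∣p∩∁q∣+∣p∩q∣ (outside ∷ p) (_ ∷ q)       = ∣p∣≡∣p∩∁q∣+∣p∩q∣ p q
∣p∣≡∣p∩∁q∣+∣p∩q∣ (inside ∷ p)  (outside ∷ q) = cong suc (∣p∣≡∣p∩∁q∣+∣p∩q∣ p q)
∣p∣≡∣p∩∁q∣+∣p∩q∣ (inside ∷ p)  (inside ∷ q)  =
  trans (cong suc (∣p∣≡∣p∩∁q∣+∣p∩q∣ p q)) (sym (+-suc _ _))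

x∈p⇒1≤∣p∣ : ∀ {n} {x : Fin n} {p} → x ∈ p → 1 ≤ ∣ p ∣
x∈p⇒1≤∣p∣ {x = x} x∈p = subst (_≤ _) (∣⁅x⁆∣≡1 x)
  (p⊆q⇒∣p∣≤∣q∣ λ y∈⁅x⁆ → subst (_∈ _) (sym (x∈⁅y⁆⇒x≡y x y∈⁅x⁆)) x∈p)

∣p∣≤1 : ∀ {n} (p : Subset n) → (∀ {x y} → x ∈ p → y ∈ p → x ≡ y) → ∣ p ∣ ≤ 1
∣p∣≤1 {n} p unique with nonempty? p
... | yes (x , x∈p) = subst (_ ≤_) (∣⁅x⁆∣≡1 x)
  (p⊆q⇒∣p∣≤∣q∣ λ y∈p → subst (_∈ ⁅ x ⁆) (unique x∈p y∈p) (x∈⁅x⁆ x))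
... | no  p-empty   = subst (_≤ 1) (sym (trans (cong ∣_∣ (Empty-unique p-empty)) (∣⊥∣≡0 n))) z≤n

∉cover⇒¬Adj : ∀ {G C} → VertexCover G C → ∀ {u v} → u ∉ C → v ∉ C → ¬ Adj G u v
∉cover⇒¬Adj cover {u} {v} u∉C v∉C uv = [ u∉C , v∉C ]′ (cover u v uv)

Adj⇒∈N : ∀ {G X u v} → u ∈ X → Adj G u v → v ∈ N G X
Adj⇒∈N {G} {X} {u} {v} u∈X uv = lookup⇒[]= v _ (trans (lookup∘tabulate _ v)
  (to T-≡ (any⁺ (λ a → lookup X a ∧ adj G a v)
    (Any.map (λ { refl → from T-∧ (from T-≡ ([]=⇒lookup u∈X) , uv) }) (∈-allFin u)))))

module Ferry (G : Graph) (C A : VSet G) (cover : VertexCover G C) (A⊆C : A ⊆ C)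
             (indA : Independent G A) (1≤∣A∣ : 1 ≤ ∣ A ∣)
             (few-neighbours : ∣ N[ G ] (∁ C) A ∣ ≤ ∣ A ∣) where

  crew : VSet G
  crew = C ∩ ∁ A

  data Role (v : Vertex G) : Set where
    anchor  : v ∈ A → Role v
    crewman : v ∈ C → v ∉ A → Role v
    late    : v ∉ C → v ∈ N G A → Role v
    ferried : v ∉ C → v ∉ N G A → Role v

  role : ∀ v → Role v
  role v with v ∈? A | v ∈? C | v ∈? N G A
  ... | yes v∈A | _       | _        = anchor v∈A
  ... | no  v∉A | yes v∈C | _        = crewman v∈C v∉A
  ... | no  _   | no  v∉C | yes v∈NA = late v∉C v∈NA
  ... | no  _   | no  v∉C | no  v∉NA = ferried v∉C v∉NA

  lastTrip : ℕ
  lastTrip = suc (n G)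

  crossing : ∀ {v} → Role v → Crossing
  crossing     (anchor _)    = crosses 0
  crossing     (crewman _ _) = aboard
  crossing     (late _ _)    = crosses lastTrip
  crossing {v} (ferried _ _) = crosses (suc (toℕ v))

  trip : Vertex G → Crossing
  trip v = crossing (role v)

  crossing-within-last : ∀ {v} (r : Role v) {j} → crossing r ≡ crosses j → j ≤ lastTrip
  crossing-within-last     (anchor _)    refl = z≤n
  crossing-within-last     (crewman _ _) ()
  crossing-within-last     (late _ _)    refl = ≤-refl
  crossing-within-last {v} (ferried _ _) refl = s≤s (<⇒≤ (toℕ<n v))

  left⇒∉C : ∀ {v k} (r : Role v) → 1 ≤ k → place (crossing r) k ≡ left → v ∉ C
  left⇒∉C {k = k} (anchor _) 1≤k at-left =
    ⊥-elim (<⇒≱ (to (place-crosses-left 0 k) at-left) 1≤k)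
  left⇒∉C (crewman _ _)   _ ()
  left⇒∉C (late v∉C _)    _ _ = v∉C
  left⇒∉C (ferried v∉C _) _ _ = v∉C

  RightBankSafe : Vertex G → Set
  RightBankSafe v = v ∈ A ⊎ (v ∉ C × v ∉ N G A)

  right⇒safe : ∀ {v k} (r : Role v) → k ≤ tripTime lastTrip →
    place (crossing r) k ≡ right → RightBankSafe v
  right⇒safe     (anchor v∈A)         _   _        = inj₁ v∈A
  right⇒safe     (crewman _ _)        _   ()
  right⇒safe {k = k} (late _ _)       k≤s at-right =
    ⊥-elim (≤⇒≯ k≤s (to (place-crosses-right lastTrip k) at-right))
  right⇒safe     (ferried v∉C v∉NA)   _   _        = inj₂ (v∉C , v∉NA)

  safe⇒¬Adj : ∀ {u v} → RightBankSafe u → RightBankSafe v → ¬ Adj G u v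
  safe⇒¬Adj {u} {v} (inj₁ u∈A)        (inj₁ v∈A)        = indA u v u∈A v∈A
  safe⇒¬Adj         (inj₁ u∈A)        (inj₂ (_ , v∉NA)) = v∉NA ∘ Adj⇒∈N {G} u∈A
  safe⇒¬Adj {u} {v} (inj₂ (_ , u∉NA)) (inj₁ v∈A)        =
    u∉NA ∘ Adj⇒∈N {G} v∈A ∘ subst T (adj-sym G u v)
  safe⇒¬Adj         (inj₂ (u∉C , _))  (inj₂ (v∉C , _))  = ∉cover⇒¬Adj {G} cover u∉C v∉C

  Passenger : ℕ → Vertex G → Set
  Passenger k v = place (trip v) k ≡ boat × v ∉ crew

  crewman∈crew : ∀ {v} → v ∈ C → v ∉ A → v ∈ crew
  crewman∈crew v∈C v∉A = x∈p∩q⁺ (v∈C , x∉p⇒x∈∁p v∉A)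

  passenger-at-start : ∀ {v} (r : Role v) → place (crossing r) 1 ≡ boat → v ∉ crew → v ∈ A
  passenger-at-start (anchor v∈A)        _       _      = v∈A
  passenger-at-start (crewman v∈C v∉A)   _       v∉crew =
    ⊥-elim (v∉crew (crewman∈crew v∈C v∉A))
  passenger-at-start (late _ _)          aboard1 _      =
    ⊥-elim (1+n≢0 (sym (tripTime-injective (to (place-crosses-boat lastTrip 1) aboard1))))
  passenger-at-start {v} (ferried _ _)   aboard1 _      =
    ⊥-elim (1+n≢0 (sym (tripTime-injective (to (place-crosses-boat (suc (toℕ v)) 1) aboard1))))

  passenger-at-end : ∀ {v} (r : Role v) → place (crossing r) (tripTime lastTrip) ≡ boat →
    v ∉ crew → v ∈ N[ G ] (∁ C) A
  passenger-at-end (anchor _)          aboard-s _      =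
    ⊥-elim (1+n≢0 (tripTime-injective {lastTrip} (to (place-crosses-boat 0 _) aboard-s)))
  passenger-at-end (crewman v∈C v∉A)   _        v∉crew =
    ⊥-elim (v∉crew (crewman∈crew v∈C v∉A))
  passenger-at-end (late v∉C v∈NA)     _        _      = x∈p∩q⁺ (v∈NA , x∉p⇒x∈∁p v∉C)
  passenger-at-end {v} (ferried _ _)   aboard-s _      = ⊥-elim (<⇒≢ (toℕ<n v)
    (suc-injective (sym (tripTime-injective (to (place-crosses-boat (suc (toℕ v)) _) aboard-s)))))

  passenger-elsewhere : ∀ {v k} (r : Role v) → k ≢ 1 → k ≢ tripTime lastTrip →
    place (crossing r) k ≡ boat → v ∉ crew → k ≡ tripTime (suc (toℕ v))
  passenger-elsewhere (anchor _)        k≢1 _   aboard-k _      =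
    ⊥-elim (k≢1 (to (place-crosses-boat 0 _) aboard-k))
  passenger-elsewhere (crewman v∈C v∉A) _   _   _        v∉crew =
    ⊥-elim (v∉crew (crewman∈crew v∈C v∉A))
  passenger-elsewhere (late _ _)        _   k≢s aboard-k _      =
    ⊥-elim (k≢s (to (place-crosses-boat lastTrip _) aboard-k))
  passenger-elsewhere {v} (ferried _ _) _   _   aboard-k _      =
    to (place-crosses-boat (suc (toℕ v)) _) aboard-k

  passengers : ℕ → VSet G
  passengers k = B (snapshot G trip k) ∩ ∁ crew

  ∈passengers⇒Passenger : ∀ {k v} → v ∈ passengers k → Passenger k v
  ∈passengers⇒Passenger v∈ with x∈p∩q⁻ _ _ v∈
  ... | v∈B , v∈∁crew = ∈-bank⁻ (positions trip _) v∈B , x∈∁p⇒x∉p v∈∁crew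

  ∣passengers∣≤∣A∣ : ∀ k → ∣ passengers k ∣ ≤ ∣ A ∣
  ∣passengers∣≤∣A∣ k with k ≟ 1 | k ≟ tripTime lastTrip
  ... | yes refl | _        = p⊆q⇒∣p∣≤∣q∣ λ {v} v∈ →
    let (aboard1 , v∉crew) = ∈passengers⇒Passenger v∈ in passenger-at-start (role v) aboard1 v∉crew
  ... | no  _    | yes refl = ≤-trans (p⊆q⇒∣p∣≤∣q∣ λ {v} v∈ →
    let (aboard-s , v∉crew) = ∈passengers⇒Passenger v∈ in passenger-at-end (role v) aboard-s v∉crew)
    few-neighbours
  ... | no  k≢1  | no  k≢s  = ≤-trans (∣p∣≤1 (passengers k) λ {u} {v} u∈ v∈ →
    let (aboard-u , u∉crew) = ∈passengers⇒Passenger u∈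
        (aboard-v , v∉crew) = ∈passengers⇒Passenger v∈
    in toℕ-injective (suc-injective (tripTime-injective (trans
         (sym (passenger-elsewhere (role u) k≢1 k≢s aboard-u u∉crew))
         (passenger-elsewhere (role v) k≢1 k≢s aboard-v v∉crew)))))
    1≤∣A∣

  ∣boat∣≤∣C∣ : ∀ k → ∣ B (snapshot G trip k) ∣ ≤ ∣ C ∣
  ∣boat∣≤∣C∣ k = begin
    ∣ Bk ∣                           ≡⟨ ∣p∣≡∣p∩∁q∣+∣p∩q∣ Bk crew ⟩
    ∣ passengers k ∣ + ∣ Bk ∩ crew ∣ ≤⟨ +-mono-≤ (∣passengers∣≤∣A∣ k) (∣p∩q∣≤∣q∣ Bk crew) ⟩
    ∣ A ∣ + ∣ crew ∣                 ≡⟨ +-comm ∣ A ∣ ∣ crew ∣ ⟩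
    ∣ crew ∣ + ∣ A ∣                 ≤⟨ +-monoʳ-≤ ∣ crew ∣ (p⊆q⇒∣p∣≤∣q∣ λ v∈A → x∈p∩q⁺ (A⊆C v∈A , v∈A)) ⟩
    ∣ crew ∣ + ∣ C ∩ A ∣             ≡⟨ sym (∣p∣≡∣p∩∁q∣+∣p∩q∣ C A) ⟩
    ∣ C ∣                            ∎
    where
    open ≤-Reasoning
    Bk = B (snapshot G trip k)

  schedule : FeasibleSchedule G ∣ C ∣
  schedule = crossings-schedule G ∣ C ∣ lastTrip trip
    (λ v → crossing-within-last (role v))
    (λ k 1≤k _ u v u∈L v∈L → ∉cover⇒¬Adj {G} cover
      (left⇒∉C (role u) 1≤k (∈-bank⁻ (positions trip k) u∈L))
      (left⇒∉C (role v) 1≤k (∈-bank⁻ (positions trip k) v∈L)))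
    (λ k _ k≤s u v u∈R v∈R → safe⇒¬Adj
      (right⇒safe (role u) k≤s (∈-bank⁻ (positions trip k) u∈R))
      (right⇒safe (role v) k≤s (∈-bank⁻ (positions trip k) v∈R)))
    (λ k _ _ → ∣boat∣≤∣C∣ k)

ferry-schedule : (G : Graph) (C A : VSet G) → VertexCover G C → A ⊆ C → Nonempty A →
  Independent G A → ∣ N[ G ] (∁ C) A ∣ ≤ ∣ A ∣ → FeasibleSchedule G ∣ C ∣
ferry-schedule G C A cover A⊆C (_ , x∈A) indA few-neighbours =
  Ferry.schedule G C A cover A⊆C indA (x∈p⇒1≤∣p∣ x∈A) few-neighbours

classTwo⇒¬schedule-of-size-β : (G : Graph) → ClassTwo G → (C : VSet G) →
  MinVertexCover G C → 1 ≤ ∣ C ∣ → ¬ FeasibleSchedule G ∣ C ∣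
classTwo⇒¬schedule-of-size-β G (β , c , (C′ , (cover′ , _) , ∣C′∣≡β) , (_ , _ , c-least) , c≡1+β)
                             C (_ , C-min) 1≤∣C∣ schedule =
  ≤⇒≯ (C-min C′ cover′) (begin
    suc ∣ C′ ∣ ≡⟨ cong suc ∣C′∣≡β ⟩
    suc β      ≡⟨ sym c≡1+β ⟩
    c          ≤⟨ c-least ∣ C ∣ 1≤∣C∣ schedule ⟩
    ∣ C ∣      ∎)
  where open ≤-Reasoning

corollary2p3 : (G : Graph) → ClassTwo G →
    (C : VSet G) → MinVertexCover G C →
    (A : VSet G) → A ⊆ C → Nonempty A → Independent G A →
    ∣ A ∣ < ∣ N[ G ] (∁ C) A ∣
corollary2p3 G classTwo C minC A A⊆C A≠∅ indA with ∣ A ∣ <ℕ? ∣ N[ G ] (∁ C) A ∣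
... | yes A<Y = A<Y
... | no  A≮Y = contradiction
  (ferry-schedule G C A (proj₁ minC) A⊆C A≠∅ indA (≮⇒≥ A≮Y))
  (classTwo⇒¬schedule-of-size-β G classTwo C minC
    (≤-trans (x∈p⇒1≤∣p∣ (proj₂ A≠∅)) (p⊆q⇒∣p∣≤∣q∣ A⊆C)))
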